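{- Let $K$ be a finite simplicial complex, let $\overrightarrow{W}$ be a Morse sequence on $K$, and let $\Upsilon$ be the Morse reference of $\overrightarrow{W}$ and $\Upsilon^*$ its Morse co-reference. Let $\sigma, \nu \in K^{(p)}$ be such that $\nu$ is critical for $\overrightarrow{W}$. Then: (1) $\nu \in \Upsilon(\sigma)$ if and only if the number of gradient paths in $\overrightarrow{W}$ from $\sigma$ to $\nu$ is odd; (2) $\nu \in \Upsilon^*(\sigma)$ if and only if the number of co-gradient paths in $\overrightarrow{W}$ from $\nu$ to $\sigma$ is odd.
   Context: A finite simplicial complex $K$ is a finite family of non-empty finite sets such that $\sigma\in K$ whenever $\emptyset\neq\sigma\subseteq\tau$ for some $\tau\in K$; elements are simplexes, $\dim\sigma=|\sigma|-1$, $K^{(p)}$ is the set of $p$-simplexes, and a facet is an inclusion-maximal simplex. For $p\ge -1$, $K[p]$ is the set of all subsets of $K^{(p)}$ (with $K^{(-1)}=\emptyset$), viewed as a $\mathbb{Z}_2$-vector space under symmetric difference (sum), the empty chain being $0$. For $\sigma\in K^{(p)}$, $\partial(\sigma)=\{\tau\in K^{(p-1)}:\tau\subset\sigma\}$ and $\delta(\sigma)=\{\tau\in K^{(p+1)}:\sigma\subset\tau\}$. A pair $(\sigma,\tau)$ with $\sigma\in K^{(p)},\tau\in K^{(p+1)}$ is a free pair for $K$ if $\tau$ is the only simplex of $K$ containing $\sigma$ (other than $\sigma$); then $K$ is an elementary expansion of $K\setminus\{\sigma,\tau\}$. If $\sigma$ is a facet of $K$, $K$ is an elementary filling of $K\setminus\{\sigma\}$.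 A Morse sequence on $K$ is a sequence $\langle\emptyset=K_0,\dots,K_k=K\rangle$ of simplicial complexes where each $K_i$ is an elementary expansion or an elementary filling of $K_{i-1}$. If $K_i=K_{i-1}\cup\{\sigma\}$ is a filling, $\sigma$ is critical; if $K_i=K_{i-1}\cup\{\sigma,\tau\}$ is an expansion with free pair $(\sigma,\tau)$, the pair $(\sigma,\tau)$ and $\sigma,\tau$ are regular. $\ddot{W}^{(p)}$ denotes the set of critical $p$-simplexes and $\ddot{W}[p]$ the set of subsets of $\ddot{W}^{(p)}$. A Morse frame on $\overrightarrow{W}$ is a map $\Upsilon$ sending each $\sigma\in K^{(p)}$ to some $\Upsilon(\sigma)\in\ddot{W}[p]$, extended linearly to chains: $\Upsilon(c)=\sum_{\sigma\in c}\Upsilon(\sigma)$ (mod 2), $\Upsilon(\emptyset)=0$. The Morse reference $\Upsilon$ of $\overrightarrow{W}$ is the unique frame with $\Upsilon(\sigma)=\{\sigma\}$ for each critical $\sigma$ and, for each regular pair $(\sigma,\tau)$, $\Upsilon(\tau)=0$ and $\Upsilon(\sigma)=\Upsilon(\partial(\tau)\setminus\{\sigma\})$. The Morse co-reference $\Upsilon^*$ is the unique frame with $\Upsilon^*(\sigma)=\{\sigma\}$ for each critical $\sigma$ and, for each regular pair $(\sigma,\tau)$, $\Upsilon^*(\sigma)=0$ and $\Upsilon^*(\tau)=\Upsilon^*(\delta(\sigma)\setminus\{\tau\})$. A gradient path from $\sigma_0$ to $\sigma_k$ is a sequence $\langle\sigma_0,\tau_0,\dots,\sigma_{k-1},\tau_{k-1},\sigma_k\rangle$,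 $k\ge0$, with $\sigma_i\in K^{(p)}$, $\tau_i\in K^{(p+1)}$, such that for each $i\in[0,k-1]$ the pair $(\sigma_i,\tau_i)$ is regular and $\sigma_{i+1}\in\partial(\tau_i)$, $\sigma_{i+1}\neq\sigma_i$ (the case $k=0$, $\langle\sigma_0\rangle$, is a trivial path). A co-gradient path from $\tau_0$ to $\tau_k$ is a sequence $\langle\tau_0,\sigma_1,\tau_1,\dots,\sigma_k,\tau_k\rangle$, $k\ge0$, with $\tau_i\in K^{(p)}$, $\sigma_i\in K^{(p-1)}$, such that for each $i\in[1,k]$ the pair $(\sigma_i,\tau_i)$ is regular and $\tau_{i-1}\in\delta(\sigma_i)$, $\tau_i\neq\tau_{i-1}$ (the case $k=0$ is a trivial path). -}

module Defs where

open import Data.Bool using (Bool; true; false; _∧_; _xor_; not; if_then_else_)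
open import Data.Nat using (ℕ; zero; suc; _<_; _≡ᵇ_; _%_)
open import Data.Nat.Properties using () renaming (_≟_ to _≟ℕ_)
open import Data.List using (List; []; _∷_; length; map; foldr)
open import Data.List.Properties using (≡-dec)
open import Data.List.Membership.Propositional using (_∈_; _∉_)
open import Data.List.Relation.Unary.All using (All)
open import Data.List.Relation.Unary.Unique.Propositional using (Unique)
open import Data.List.Relation.Unary.Linked using (Linked)
open import Data.Product using (Σ; _×_; _,_; ∃)
open import Data.Sum using (_⊎_)
open import Data.Empty using (⊥)
open import Data.Unit using (⊤)
open import Relation.Nullary using (¬_; does)
open import Relation.Binary.PropositionalEquality using (_≡_; _≢_)
open import Function.Bundles using (_⇔_)

-- A simplex (a non-empty finite set of
-- vertices) is represented canonically as a non-empty strictly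
-- increasing list of naturals, so that set equality is list equality.

Simplex : Set
Simplex = List ℕ

ValidSimplex : Simplex → Set
ValidSimplex s = (s ≢ []) × Linked _<_ s

_⊆_ : Simplex → Simplex → Set
s ⊆ t = All (_∈ t) s

anyᵇ : {A : Set} → (A → Bool) → List A → Bool
anyᵇ f [] = false
anyᵇ f (x ∷ xs) = if f x then true else anyᵇ f xs

allᵇ : {A : Set} → (A → Bool) → List A → Bool
allᵇ f [] = true
allᵇ f (x ∷ xs) = f x ∧ allᵇ f xs

filterᵇ : {A : Set} → (A → Bool) → List A → List A
filterᵇ f [] = []
filterᵇ f (x ∷ xs) = if f x then x ∷ filterᵇ f xs else filterᵇ f xs

_∈ᵇ_ : ℕ → Simplex → Bool
x ∈ᵇ t = anyᵇ (λ y → does (x ≟ℕ y)) t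

_⊆ᵇ_ : Simplex → Simplex → Bool
s ⊆ᵇ t = allᵇ (λ x → x ∈ᵇ t) s

_==_ : Simplex → Simplex → Bool
s == t = does (≡-dec _≟ℕ_ s t)

isCodim1 : Simplex → Simplex → Bool
isCodim1 s t = (s ⊆ᵇ t) ∧ (length t ≡ᵇ suc (length s))

Complex : Set
Complex = List Simplex

IsComplex : Complex → Set
IsComplex K =
    Unique K
  × (∀ s → s ∈ K → ValidSimplex s)
  × (∀ t s → t ∈ K → ValidSimplex s → s ⊆ t → s ∈ K)

∂ : Complex → Simplex → List Simplex
∂ K τ = filterᵇ (λ s → isCodim1 s τ) K

δ : Complex → Simplex → List Simplex
δ K σ = filterᵇ (λ t → isCodim1 σ t) K

_∖_ : List Simplex → Simplex → List Simplex
c ∖ σ = filterᵇ (λ s → not (s == σ)) c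

-- Morse sequences, given by their steps: a filling adds a critical
-- simplex σ, an expansion adds a regular pair (σ , τ).

data Step : Set where
  fill   : Simplex → Step
  expand : Simplex → Simplex → Step

ElemFilling : Complex → Simplex → Set
ElemFilling L σ =
    IsComplex (σ ∷ L)
  × (∀ ρ → ρ ∈ (σ ∷ L) → σ ⊆ ρ → ρ ≡ σ)

ElemExpansion : Complex → Simplex → Simplex → Set
ElemExpansion L σ τ =
    IsComplex (σ ∷ τ ∷ L)
  × (length τ ≡ suc (length σ))
  × σ ⊆ τ
  × (∀ ρ → ρ ∈ (σ ∷ τ ∷ L) → σ ⊆ ρ → (ρ ≡ σ) ⊎ (ρ ≡ τ))

ValidSteps : Complex → List Step → Set
ValidSteps L [] = ⊤
ValidSteps L (fill σ ∷ ws) = ElemFilling L σ × ValidSteps (σ ∷ L) ws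
ValidSteps L (expand σ τ ∷ ws) = ElemExpansion L σ τ × ValidSteps (σ ∷ τ ∷ L) ws

added : List Step → List Simplex
added [] = []
added (fill σ ∷ ws) = σ ∷ added ws
added (expand σ τ ∷ ws) = σ ∷ τ ∷ added ws

IsMorseSeq : Complex → List Step → Set
IsMorseSeq K ws = ValidSteps [] ws × (∀ s → (s ∈ K) ⇔ (s ∈ added ws))

Critical : List Step → Simplex → Set
Critical ws σ = fill σ ∈ ws

RegularPair : List Step → Simplex → Simplex → Set
RegularPair ws σ τ = expand σ τ ∈ ws

-- Morse frames.  A frame Υ is represented by its characteristic
-- function: Υ σ ν ≡ true  means  ν ∈ Υ(σ).

Frame : Set
Frame = Simplex → Simplex → Bool

-- ν ∈ Υ(c) for a chain c (a duplicate-free list): the number of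
-- s ∈ c with ν ∈ Υ(s) is odd (linear extension mod 2)
evalChain : Frame → List Simplex → Simplex → Bool
evalChain Υ c ν = foldr _xor_ false (map (λ s → Υ s ν) c)

IsFrame : Complex → List Step → Frame → Set
IsFrame K ws Υ =
  ∀ σ ν → σ ∈ K → Υ σ ν ≡ true → Critical ws ν × (length ν ≡ length σ)

IsMorseReference : Complex → List Step → Frame → Set
IsMorseReference K ws Υ =
    IsFrame K ws Υ
  × (∀ σ → Critical ws σ → ∀ ν → Υ σ ν ≡ (σ == ν))
  × (∀ σ τ → RegularPair ws σ τ →
       (∀ ν → Υ τ ν ≡ false)
     × (∀ ν → Υ σ ν ≡ evalChain Υ (∂ K τ ∖ σ) ν))

IsMorseCoReference : Complex → List Step → Frame → Set
IsMorseCoReference K ws Υ =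
    IsFrame K ws Υ
  × (∀ σ → Critical ws σ → ∀ ν → Υ σ ν ≡ (σ == ν))
  × (∀ σ τ → RegularPair ws σ τ →
       (∀ ν → Υ σ ν ≡ false)
     × (∀ ν → Υ τ ν ≡ evalChain Υ (δ K σ ∖ τ) ν))

-- Gradient paths ⟨σ₀, τ₀, σ₁, …, τ_{k-1}, σ_k⟩ as lists of simplexes.

GradTail : Complex → List Step → Simplex → Simplex → List Simplex → Set
GradTail K ws x ν [] = x ≡ ν
GradTail K ws x ν (t ∷ []) = ⊥
GradTail K ws x ν (t ∷ y ∷ r) =
  RegularPair ws x t × y ∈ ∂ K t × y ≢ x × GradTail K ws y ν r

GradientPath : Complex → List Step → Simplex → Simplex → List Simplex → Set
GradientPath K ws σ ν [] = ⊥
GradientPath K ws σ ν (x ∷ r) = (x ≡ σ) × GradTail K ws x ν r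

-- Co-gradient paths ⟨τ₀, σ₁, τ₁, …, σ_k, τ_k⟩.
CoGradTail : Complex → List Step → Simplex → Simplex → List Simplex → Set
CoGradTail K ws t ρ [] = t ≡ ρ
CoGradTail K ws t ρ (s ∷ []) = ⊥
CoGradTail K ws t ρ (s ∷ t' ∷ r) =
  RegularPair ws s t' × t ∈ δ K s × t' ≢ t × CoGradTail K ws t' ρ r

CoGradientPath : Complex → List Step → Simplex → Simplex → List Simplex → Set
CoGradientPath K ws τ ρ [] = ⊥
CoGradientPath K ws τ ρ (x ∷ r) = (x ≡ τ) × CoGradTail K ws x ρ r

MemberIffOddCount : {A : Set} → (A → Set) → Bool → Set
MemberIffOddCount {A} P b =
  Σ (List A) λ ps →
      Unique ps
    × (∀ π → (π ∈ ps) ⇔ P π)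
    × ((b ≡ true) ⇔ (length ps % 2 ≡ 1))

-- Both sides obey the same recursion along the Morse sequence.  For a regular
-- pair (σ, τ), a non-trivial gradient path from σ is σ, τ followed by a
-- gradient path from a face of τ other than σ; these faces were added before
-- the pair, and Υ(σ) = Υ(∂(τ) ∖ σ) is the matching sum.  Dually, a
-- non-trivial co-gradient path ending at τ extends one ending at a coface of σ
-- other than τ; as (σ, τ) is a free pair these cofaces are added later, and
-- Υ*(τ) = Υ*(δ(σ) ∖ τ).  A critical simplex carries only the trivial path and
-- the other member of a regular pair none, and since the path sets in each sum
-- are disjoint, counting them mod 2 turns the union into the xor of the
-- parities.

{-# OPTIONS --safe #-}
module Submission where

open import Defs
open import Data.Bool using (Bool; true; false; not; _xor_; T)
open import Data.Bool.Properties using (not-distribˡ-xor; not-involutive; T-∧; T-≡)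
open import Data.Nat using (ℕ; zero; suc; _+_; _%_; _≡ᵇ_)
open import Data.Nat.Properties using (≡ᵇ⇒≡; 1+n≢n) renaming (_≟_ to _≟ℕ_)
open import Data.List using (List; []; _∷_; [_]; _++_; length; map; foldr)
import Data.List as List
open import Data.List.Properties using (≡-dec; length-++; length-map; ∷-injectiveʳ; ++-cancelʳ)
open import Data.List.Membership.Propositional using (_∈_; _∉_)
open import Data.List.Membership.Propositional.Properties
  using (∈-filter⁺; ∈-filter⁻; ∈-++⁺ˡ; ∈-++⁺ʳ; ∈-++⁻; ∈-map⁺; ∈-map⁻)
open import Data.List.Relation.Unary.Any using (here; there)
open import Data.List.Relation.Unary.Any.Properties using (++↔)
open import Data.List.Relation.Unary.All as All using (All; []; _∷_)
open import Data.List.Relation.Unary.AllPairs using ([]; _∷_)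
open import Data.List.Relation.Unary.Unique.Propositional using (Unique)
import Data.List.Relation.Unary.Unique.Propositional.Properties as Unique
open import Data.List.Relation.Binary.Disjoint.Propositional using (Disjoint)
open import Data.Product using (_×_; _,_; proj₁; proj₂; ∃-syntax)
open import Data.Sum using (_⊎_; inj₁; inj₂; map₁)
open import Data.Sum.Function.Propositional using (_⊎-⇔_)
open import Data.Product.Function.NonDependent.Propositional using (_×-⇔_)
open import Data.Empty using (⊥-elim)
open import Data.Unit using (tt)
open import Function using (_∘_)
open import Function.Bundles using (_⇔_; mk⇔; Equivalence)
open import Function.Properties.Equivalence
  using () renaming (refl to ⇔-refl; sym to ⇔-sym; trans to ⇔-trans)
open import Function.Properties.Inverse using (↔⇒⇔)
open import Relation.Nullary using (¬_; yes; no; T?)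
open import Relation.Binary.PropositionalEquality using (_≡_; _≢_; refl; sym; trans; cong; subst)

open Equivalence using (to; from)

-- Parity of a count

odd : ℕ → Bool
odd zero    = false
odd (suc n) = not (odd n)

odd-+ : ∀ m n → odd (m + n) ≡ odd m xor odd n
odd-+ zero    n = refl
odd-+ (suc m) n = trans (cong not (odd-+ m n)) (not-distribˡ-xor (odd m) (odd n))

odd⇔%2≡1 : ∀ n → (odd n ≡ true) ⇔ (n % 2 ≡ 1)
odd⇔%2≡1 zero          = mk⇔ (λ ()) (λ ())
odd⇔%2≡1 (suc zero)    = mk⇔ (λ _ → refl) (λ _ → refl)
odd⇔%2≡1 (suc (suc n)) rewrite not-involutive (odd n) = odd⇔%2≡1 n

CountParity : {A : Set} → (A → Set) → Bool → Set
CountParity {A} P b =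
  ∃[ ps ] Unique ps × (∀ π → (π ∈ ps) ⇔ P π) × (b ≡ odd (length ps))

module _ {A : Set} where

  countParity⇒memberIffOddCount : {P : A → Set} {b : Bool} →
                                  CountParity P b → MemberIffOddCount P b
  countParity⇒memberIffOddCount (ps , u , ∈⇔P , refl) = ps , u , ∈⇔P , odd⇔%2≡1 (length ps)

  countParity-cong : {P Q : A → Set} {b : Bool} →
                     (∀ π → P π ⇔ Q π) → CountParity P b → CountParity Q b
  countParity-cong P⇔Q (ps , u , ∈⇔P , b≡) = ps , u , (λ π → ⇔-trans (∈⇔P π) (P⇔Q π)) , b≡

  countParity-empty : {P : A → Set} → (∀ π → ¬ P π) → CountParity P false
  countParity-empty ¬P = [] , [] , (λ π → mk⇔ (λ ()) (⊥-elim ∘ ¬P π)) , refl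

  countParity-singleton : {P : A → Set} (π₀ : A) → (∀ π → P π ⇔ (π ≡ π₀)) → CountParity P true
  countParity-singleton π₀ P⇔ =
    [ π₀ ] , [] ∷ [] ,
    (λ π → mk⇔ (λ { (here π≡π₀) → from (P⇔ π) π≡π₀ ; (there ()) }) (here ∘ to (P⇔ π))) , refl

  countParity-⊎ : {P Q : A → Set} {a b : Bool} → CountParity P a → CountParity Q b →
                  (∀ π → P π → ¬ Q π) → CountParity (λ π → P π ⊎ Q π) (a xor b)
  countParity-⊎ (ps , ps! , ∈⇔P , refl) (qs , qs! , ∈⇔Q , refl) P⇒¬Q =
    ps ++ qs ,
    Unique.++⁺ ps! qs! (λ { {π} (π∈ps , π∈qs) → P⇒¬Q π (to (∈⇔P π) π∈ps) (to (∈⇔Q π) π∈qs) }) ,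
    (λ π → ⇔-trans (⇔-sym (↔⇒⇔ (++↔ {xs = ps}))) (∈⇔P π ⊎-⇔ ∈⇔Q π)) ,
    trans (sym (odd-+ (length ps) (length qs))) (cong odd (sym (length-++ ps)))

  countParity-⋃ : {I : Set} (Q : I → A → Set) (f : I → Bool) {is : List I} → Unique is →
                  (∀ i → i ∈ is → CountParity (Q i) (f i)) →
                  (∀ i j π → Q i π → Q j π → i ≡ j) →
                  CountParity (λ π → ∃[ i ] i ∈ is × Q i π) (foldr _xor_ false (map f is))
  countParity-⋃ Q f {[]} _ _ _ = countParity-empty λ { π (_ , () , _) }
  countParity-⋃ Q f {i ∷ is} (i∉is ∷ is!) Qi disjoint =
    countParity-cong split
      (countParity-⊎ (Qi i (here refl)) (countParity-⋃ Q f is! (λ j → Qi j ∘ there) disjoint)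
                     λ { π Qiπ (j , j∈is , Qjπ) → All.lookup i∉is j∈is (disjoint i j π Qiπ Qjπ) })
    where
    split : ∀ π → (Q i π ⊎ ∃[ j ] j ∈ is × Q j π) ⇔ (∃[ j ] j ∈ i ∷ is × Q j π)
    split π = mk⇔ (λ { (inj₁ Qiπ)              → i , here refl , Qiπ
                     ; (inj₂ (j , j∈is , Qjπ)) → j , there j∈is , Qjπ })
                  (λ { (j , here refl , Qjπ)   → inj₁ Qjπ
                     ; (j , there j∈is , Qjπ)  → inj₂ (j , j∈is , Qjπ) })

  countParity-image : {B : Set} {Q : B → Set} {b : Bool} (g : B → A) →
                      (∀ {x y} → g x ≡ g y → x ≡ y) → CountParity Q b →
                      CountParity (λ π → ∃[ π′ ] π ≡ g π′ × Q π′) b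
  countParity-image g g-injective (ps , ps! , ∈⇔Q , refl) =
    map g ps , Unique.map⁺ g-injective ps! ,
    (λ π → mk⇔ (λ π∈ → let π′ , π′∈ps , π≡ = ∈-map⁻ g π∈ in π′ , π≡ , to (∈⇔Q π′) π′∈ps)
               (λ { (π′ , refl , Qπ′) → ∈-map⁺ g (from (∈⇔Q π′) Qπ′) })) ,
    cong odd (sym (length-map g ps))

countParity-== : ∀ {A : Set} {P : A → Set} (π₀ : A) (x y : Simplex) →
                 (∀ π → P π ⇔ (x ≡ y × π ≡ π₀)) → CountParity P (x == y)
countParity-== π₀ x y P⇔ with ≡-dec _≟ℕ_ x y
... | yes x≡y = countParity-singleton π₀ λ π → ⇔-trans (P⇔ π) (mk⇔ proj₂ (x≡y ,_))
... | no x≢y  = countParity-empty λ π → x≢y ∘ proj₁ ∘ to (P⇔ π)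

-- Boundaries and coboundaries

filterᵇ≡filter : {A : Set} (f : A → Bool) (xs : List A) → filterᵇ f xs ≡ List.filterᵇ f xs
filterᵇ≡filter f []       = refl
filterᵇ≡filter f (x ∷ xs) with f x
... | true  = cong (x ∷_) (filterᵇ≡filter f xs)
... | false = filterᵇ≡filter f xs

module _ {A : Set} (f : A → Bool) {xs : List A} where

  ∈-filterᵇ : ∀ {y} → y ∈ filterᵇ f xs ⇔ (y ∈ xs × T (f y))
  ∈-filterᵇ rewrite filterᵇ≡filter f xs =
    mk⇔ (∈-filter⁻ (T? ∘ f)) (λ (y∈ , fy) → ∈-filter⁺ (T? ∘ f) y∈ fy)

  filterᵇ-unique : Unique xs → Unique (filterᵇ f xs)
  filterᵇ-unique xs! rewrite filterᵇ≡filter f xs = Unique.filter⁺ (T? ∘ f) xs!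

T-not-==⇔≢ : ∀ s t → T (not (s == t)) ⇔ (s ≢ t)
T-not-==⇔≢ s t with ≡-dec _≟ℕ_ s t
... | yes s≡t = mk⇔ (λ ()) (λ s≢t → s≢t s≡t)
... | no s≢t  = mk⇔ (λ _ → s≢t) (λ _ → tt)

∈-∖ : ∀ {c σ y} → y ∈ c ∖ σ ⇔ (y ∈ c × y ≢ σ)
∈-∖ {σ = σ} {y} = ⇔-trans (∈-filterᵇ (λ s → not (s == σ))) (⇔-refl ×-⇔ T-not-==⇔≢ y σ)

∈ᵇ⇒∈ : ∀ x t → T (x ∈ᵇ t) → x ∈ t
∈ᵇ⇒∈ x (y ∷ t) h with x ≡ᵇ y in x≡ᵇy
... | true  = here (≡ᵇ⇒≡ x y (from T-≡ x≡ᵇy))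
... | false = there (∈ᵇ⇒∈ x t h)

⊆ᵇ⇒⊆ : ∀ s t → T (s ⊆ᵇ t) → s ⊆ t
⊆ᵇ⇒⊆ []      t _ = []
⊆ᵇ⇒⊆ (x ∷ s) t h = let x∈t , s⊆t = to (T-∧ {x ∈ᵇ t}) h in ∈ᵇ⇒∈ x t x∈t ∷ ⊆ᵇ⇒⊆ s t s⊆t

isCodim1⇒properFace : ∀ s t → T (isCodim1 s t) → s ⊆ t × s ≢ t
isCodim1⇒properFace s t h =
  let s⊆t , len = to (T-∧ {s ⊆ᵇ t}) h in
  ⊆ᵇ⇒⊆ s t s⊆t , λ { refl → 1+n≢n (sym (≡ᵇ⇒≡ (length t) (suc (length t)) len)) }

∈-∂ : ∀ {K τ y} → y ∈ ∂ K τ → y ∈ K × y ⊆ τ × y ≢ τ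
∈-∂ {τ = τ} {y} y∈ = let y∈K , cd = to (∈-filterᵇ _) y∈ in y∈K , isCodim1⇒properFace y τ cd

∈-δ : ∀ {K σ y} → y ∈ δ K σ → y ∈ K × σ ⊆ y × σ ≢ y
∈-δ {σ = σ} {y} y∈ = let y∈K , cd = to (∈-filterᵇ _) y∈ in y∈K , isCodim1⇒properFace σ y cd

∖-∂-unique : ∀ {K} → Unique K → ∀ τ σ → Unique (∂ K τ ∖ σ)
∖-∂-unique K! τ σ = filterᵇ-unique _ (filterᵇ-unique _ K!)

∖-δ-unique : ∀ {K} → Unique K → ∀ σ τ → Unique (δ K σ ∖ τ)
∖-δ-unique K! σ τ = filterᵇ-unique _ (filterᵇ-unique _ K!)

-- Morse sequences

added-∷ : ∀ st ws → added (st ∷ ws) ≡ added [ st ] ++ added ws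
added-∷ (fill _)     _ = refl
added-∷ (expand _ _) _ = refl

added-∈ : ∀ {st ws x} → st ∈ ws → x ∈ added [ st ] → x ∈ added ws
added-∈ {st} {_ ∷ ws} (here refl) x∈ rewrite added-∷ st ws = ∈-++⁺ˡ x∈
added-∈ {_} {st ∷ ws} (there st∈) x∈ rewrite added-∷ st ws = ∈-++⁺ʳ (added [ st ]) (added-∈ st∈ x∈)

unique-++⁻ : ∀ {A : Set} (xs : List A) {ys} → Unique (xs ++ ys) → Unique ys × Disjoint xs ys
unique-++⁻ []       ys!        = ys! , λ ()
unique-++⁻ (x ∷ xs) (x∉ ∷ xs++ys!) =
  let ys! , xs#ys = unique-++⁻ xs xs++ys! in
  ys! , λ { (here refl , v∈ys) → All.lookup x∉ (∈-++⁺ʳ xs v∈ys) refl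
          ; (there v∈xs , v∈ys) → xs#ys (v∈xs , v∈ys) }

unique-added-∷ : ∀ st ws → Unique (added (st ∷ ws)) →
                 Unique (added ws) × Disjoint (added [ st ]) (added ws)
unique-added-∷ st ws u = unique-++⁻ (added [ st ]) (subst Unique (added-∷ st ws) u)

added-unique : ∀ {L ws} → ValidSteps L ws → Unique (added ws) × Disjoint (added ws) L
added-unique {ws = []} _ = [] , λ ()
added-unique {L} {fill σ ∷ ws} ((((σ∉L ∷ _) , _) , _) , steps) =
  let ws! , ws#σL = added-unique steps in
  All.tabulate (λ x∈ σ≡x → ws#σL (x∈ , here (sym σ≡x))) ∷ ws! ,
  λ { (here refl , x∈L) → All.lookup σ∉L x∈L refl
    ; (there x∈ , x∈L) → ws#σL (x∈ , there x∈L) }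
added-unique {L} {expand σ τ ∷ ws} ((((σ∉τL ∷ τ∉L ∷ _) , _) , _) , steps) =
  let ws! , ws#στL = added-unique steps in
  (All.head σ∉τL ∷ All.tabulate (λ x∈ σ≡x → ws#στL (x∈ , here (sym σ≡x)))) ∷
  All.tabulate (λ x∈ τ≡x → ws#στL (x∈ , there (here (sym τ≡x)))) ∷ ws! ,
  λ { (here refl , x∈L) → All.lookup σ∉τL (there x∈L) refl
    ; (there (here refl) , x∈L) → All.lookup τ∉L x∈L refl
    ; (there (there x∈) , x∈L) → ws#στL (x∈ , there (there x∈L)) }

step-unique : ∀ {ws st₁ st₂ x} → Unique (added ws) → st₁ ∈ ws → st₂ ∈ ws →
              x ∈ added [ st₁ ] → x ∈ added [ st₂ ] → st₁ ≡ st₂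
step-unique u (here refl) (here refl) _ _ = refl
step-unique {st ∷ ws} u (here refl) (there st₂∈) x∈₁ x∈₂ =
  ⊥-elim (proj₂ (unique-added-∷ st ws u) (x∈₁ , added-∈ st₂∈ x∈₂))
step-unique {st ∷ ws} u (there st₁∈) (here refl) x∈₁ x∈₂ =
  ⊥-elim (proj₂ (unique-added-∷ st ws u) (x∈₂ , added-∈ st₁∈ x∈₁))
step-unique {st ∷ ws} u (there st₁∈) (there st₂∈) =
  step-unique (proj₁ (unique-added-∷ st ws u)) st₁∈ st₂∈

expand-irreflexive : ∀ {ws x} → Unique (added ws) → expand x x ∉ ws
expand-irreflexive (x≢ ∷ _) (here refl) = All.head x≢ refl
expand-irreflexive {st ∷ ws} u (there x∈) = expand-irreflexive (proj₁ (unique-added-∷ st ws u)) x∈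

module MorseSequence {ws : List Step} (ws! : Unique (added ws)) where

  critical-not-lower : ∀ {σ τ} → Critical ws σ → ¬ RegularPair ws σ τ
  critical-not-lower c r with step-unique ws! c r (here refl) (here refl)
  ... | ()

  critical-not-upper : ∀ {σ τ} → Critical ws τ → ¬ RegularPair ws σ τ
  critical-not-upper c r with step-unique ws! c r (here refl) (there (here refl))
  ... | ()

  upper-not-lower : ∀ {ρ σ τ} → RegularPair ws ρ σ → ¬ RegularPair ws σ τ
  upper-not-lower r r′ with step-unique ws! r r′ (there (here refl)) (here refl)
  ... | refl = expand-irreflexive ws! r

  regularPair-upper-unique : ∀ {σ τ τ′} → RegularPair ws σ τ → RegularPair ws σ τ′ → τ ≡ τ′
  regularPair-upper-unique r r′ with step-unique ws! r r′ (here refl) (here refl)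
  ... | refl = refl

  regularPair-lower-unique : ∀ {σ σ′ τ} → RegularPair ws σ τ → RegularPair ws σ′ τ → σ ≡ σ′
  regularPair-lower-unique r r′ with step-unique ws! r r′ (there (here refl)) (there (here refl))
  ... | refl = refl

move-prefix : ∀ {A : Set} (xs : List A) {ys zs y} → y ∈ ys ⊎ y ∈ xs ++ zs → y ∈ xs ++ ys ⊎ y ∈ zs
move-prefix xs (inj₁ y∈ys) = inj₁ (∈-++⁺ʳ xs y∈ys)
move-prefix xs (inj₂ y∈)   = map₁ ∈-++⁺ˡ (∈-++⁻ xs y∈)

module _ (K : Complex) (P : Simplex → Set) where

  forward-induction : IsComplex K → ∀ {L ws} → ValidSteps L ws → All P L →
    (∀ {σ} → fill σ ∈ ws → P σ) →
    (∀ {σ τ} → expand σ τ ∈ ws → P τ) →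
    (∀ {σ τ} → expand σ τ ∈ ws → (∀ y → y ∈ ∂ K τ ∖ σ → P y) → P σ) →
    All P (added ws)
  forward-induction _ {ws = []} _ _ _ _ _ = []
  forward-induction KC {ws = fill σ ∷ ws} (_ , steps) PL critical upper lower =
    Pσ ∷ forward-induction KC steps (Pσ ∷ PL)
           (critical ∘ there) (λ r → upper (there r)) (λ r → lower (there r))
    where
    Pσ : P σ
    Pσ = critical (here refl)
  forward-induction KC {L} {expand σ τ ∷ ws} (((_ , _ , closed) , _) , steps)
                    PL critical upper lower =
    Pσ ∷ Pτ ∷ forward-induction KC steps (Pσ ∷ Pτ ∷ PL)
                (critical ∘ there) (λ r → upper (there r)) (λ r → lower (there r))
    where
    earlier-face : ∀ {y} → y ∈ ∂ K τ ∖ σ → y ∈ L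
    earlier-face y∈ with to ∈-∖ y∈
    ... | y∈∂ , y≢σ with ∈-∂ y∈∂
    ... | y∈K , y⊆τ , y≢τ with closed τ _ (there (here refl)) (proj₁ (proj₂ KC) _ y∈K) y⊆τ
    ... | here y≡σ         = ⊥-elim (y≢σ y≡σ)
    ... | there (here y≡τ) = ⊥-elim (y≢τ y≡τ)
    ... | there (there y∈L) = y∈L
    Pτ : P τ
    Pτ = upper (here refl)
    Pσ : P σ
    Pσ = lower (here refl) (λ y y∈ → All.lookup PL (earlier-face y∈))

  backward-induction : ∀ {L ws} → ValidSteps L ws → (∀ {y} → y ∈ K → y ∈ L ⊎ y ∈ added ws) →
    (∀ {σ} → fill σ ∈ ws → P σ) →
    (∀ {σ τ} → expand σ τ ∈ ws → P σ) →
    (∀ {σ τ} → expand σ τ ∈ ws → (∀ y → y ∈ δ K σ ∖ τ → P y) → P τ) →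
    All P (added ws)
  backward-induction {ws = []} _ _ _ _ _ = []
  backward-induction {ws = fill σ ∷ ws} (_ , steps) K⊆ critical lower upper =
    critical (here refl) ∷
    backward-induction steps (move-prefix [ σ ] ∘ K⊆)
      (critical ∘ there) (λ r → lower (there r)) (λ r → upper (there r))
  backward-induction {L} {expand σ τ ∷ ws} ((_ , _ , _ , free) , steps) K⊆ critical lower upper =
    lower (here refl) ∷ upper (here refl) (λ y y∈ → All.lookup Pws (later-coface y∈)) ∷ Pws
    where
    K⊆′ : ∀ {y} → y ∈ K → y ∈ σ ∷ τ ∷ L ⊎ y ∈ added ws
    K⊆′ = move-prefix (σ ∷ τ ∷ []) ∘ K⊆
    Pws : All P (added ws)
    Pws = backward-induction steps K⊆′
            (critical ∘ there) (λ r → lower (there r)) (λ r → upper (there r))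
    later-coface : ∀ {y} → y ∈ δ K σ ∖ τ → y ∈ added ws
    later-coface y∈ with to ∈-∖ y∈
    ... | y∈δ , y≢τ with ∈-δ y∈δ
    ... | y∈K , σ⊆y , σ≢y with K⊆′ y∈K
    ... | inj₂ y∈ws = y∈ws
    ... | inj₁ y∈στL with free _ y∈στL σ⊆y
    ... | inj₁ y≡σ = ⊥-elim (σ≢y (sym y≡σ))
    ... | inj₂ y≡τ = ⊥-elim (y≢τ y≡τ)

-- Gradient paths

module GradientPaths
  {K ws Υ ν} (KC : IsComplex K) (steps : ValidSteps [] ws)
  (Υ-critical : ∀ σ → Critical ws σ → ∀ ν → Υ σ ν ≡ (σ == ν))
  (Υ-regular : ∀ σ τ → RegularPair ws σ τ →
                 (∀ ν → Υ τ ν ≡ false) × (∀ ν → Υ σ ν ≡ evalChain Υ (∂ K τ ∖ σ) ν))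
  (ν-critical : Critical ws ν) where

  open MorseSequence (proj₁ (added-unique steps))

  PathParity : Simplex → Set
  PathParity x = CountParity (GradientPath K ws x ν) (Υ x ν)

  critical-parity : ∀ {x} → Critical ws x → PathParity x
  critical-parity {x} c =
    subst (CountParity _) (sym (Υ-critical x c ν)) (countParity-== [ x ] x ν paths)
    where
    paths : ∀ π → GradientPath K ws x ν π ⇔ (x ≡ ν × π ≡ [ x ])
    paths π = mk⇔ (only-trivial π) λ { (refl , refl) → refl , refl }
      where
      only-trivial : ∀ π → GradientPath K ws x ν π → x ≡ ν × π ≡ [ x ]
      only-trivial (_ ∷ [])        (refl , x≡ν)    = x≡ν , refl
      only-trivial (_ ∷ _ ∷ _ ∷ _) (refl , r , _) = ⊥-elim (critical-not-lower c r)

  upper-parity : ∀ {s x} → RegularPair ws s x → PathParity x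
  upper-parity {s} {x} r =
    subst (CountParity _) (sym (proj₁ (Υ-regular s x r) ν)) (countParity-empty no-path)
    where
    no-path : ∀ π → ¬ GradientPath K ws x ν π
    no-path (_ ∷ [])        (refl , refl)   = critical-not-upper ν-critical r
    no-path (_ ∷ _ ∷ _ ∷ _) (refl , r′ , _) = upper-not-lower r r′

  lower-parity : ∀ {x t} → RegularPair ws x t → (∀ y → y ∈ ∂ K t ∖ x → PathParity y) → PathParity x
  lower-parity {x} {t} r IH =
    subst (CountParity _) (sym (proj₂ (Υ-regular x t r) ν))
      (countParity-cong paths
        (countParity-image (λ π → x ∷ t ∷ π) (∷-injectiveʳ ∘ ∷-injectiveʳ)
          (countParity-⋃ (λ y → GradientPath K ws y ν) (λ y → Υ y ν)
            (∖-∂-unique (proj₁ KC) t x) IH same-start)))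
    where
    same-start : ∀ y y′ π → GradientPath K ws y ν π → GradientPath K ws y′ ν π → y ≡ y′
    same-start y y′ (_ ∷ _) (refl , _) (refl , _) = refl
    Extension : List Simplex → Set
    Extension π = ∃[ π′ ] π ≡ x ∷ t ∷ π′ × ∃[ y ] y ∈ ∂ K t ∖ x × GradientPath K ws y ν π′
    extend : ∀ π → Extension π → GradientPath K ws x ν π
    extend _ (_ ∷ _ , refl , y , y∈ , refl , tail) =
      let y∈∂ , y≢x = to ∈-∖ y∈ in refl , r , y∈∂ , y≢x , tail
    restrict : ∀ π → GradientPath K ws x ν π → Extension π
    restrict (_ ∷ [])          (refl , refl) = ⊥-elim (critical-not-lower ν-critical r)
    restrict (_ ∷ _ ∷ y ∷ π′) (refl , r′ , y∈∂ , y≢x , tail) with regularPair-upper-unique r r′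
    ... | refl = y ∷ π′ , refl , y , from ∈-∖ (y∈∂ , y≢x) , refl , tail
    paths : ∀ π → Extension π ⇔ GradientPath K ws x ν π
    paths π = mk⇔ (extend π) (restrict π)

  parities : All PathParity (added ws)
  parities = forward-induction K PathParity KC steps [] critical-parity upper-parity lower-parity

-- Co-gradient paths

module _ {K : Complex} {ws : List Step} where

  EndsWithStep : Simplex → Simplex → List Simplex → Set
  EndsWithStep t x π =
    ∃[ π′ ] ∃[ s ] ∃[ τ′ ] π ≡ π′ ++ s ∷ x ∷ [] × CoGradTail K ws t τ′ π′
                           × RegularPair ws s x × τ′ ∈ δ K s × x ≢ τ′

  coGradTail-∷ʳ : ∀ {t τ′ s x} π → CoGradTail K ws t τ′ π →
                  RegularPair ws s x → τ′ ∈ δ K s → x ≢ τ′ → CoGradTail K ws t x (π ++ s ∷ x ∷ [])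
  coGradTail-∷ʳ []          refl                   r τ′∈ x≢τ′ = r , τ′∈ , x≢τ′ , refl
  coGradTail-∷ʳ (_ ∷ _ ∷ π) (r₀ , t∈ , t₀≢t , tail) r τ′∈ x≢τ′ =
    r₀ , t∈ , t₀≢t , coGradTail-∷ʳ π tail r τ′∈ x≢τ′

  coGradTail-last : ∀ {t x} π → CoGradTail K ws t x π → (π ≡ [] × t ≡ x) ⊎ EndsWithStep t x π
  coGradTail-last []            t≡x                     = inj₁ (refl , t≡x)
  coGradTail-last (s₀ ∷ t₀ ∷ π) (r₀ , t∈ , t₀≢t , tail) with coGradTail-last π tail
  ... | inj₁ (refl , refl) = inj₂ ([] , s₀ , _ , refl , refl , r₀ , t∈ , t₀≢t)
  ... | inj₂ (π′ , s , τ′ , refl , tail′ , r , τ′∈ , x≢τ′) =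
    inj₂ (s₀ ∷ t₀ ∷ π′ , s , τ′ , refl , (r₀ , t∈ , t₀≢t , tail′) , r , τ′∈ , x≢τ′)

  coGradTail-end-unique : ∀ {t x x′} π → CoGradTail K ws t x π → CoGradTail K ws t x′ π → x ≡ x′
  coGradTail-end-unique []          refl            refl             = refl
  coGradTail-end-unique (_ ∷ _ ∷ π) (_ , _ , _ , tail) (_ , _ , _ , tail′) =
    coGradTail-end-unique π tail tail′

  coGradientPath-parity : ∀ {ν σ b} → CountParity (CoGradTail K ws ν σ) b →
                          CountParity (CoGradientPath K ws ν σ) b
  coGradientPath-parity {ν} {σ} tails =
    countParity-cong paths (countParity-image (ν ∷_) ∷-injectiveʳ tails)
    where
    paths : ∀ π → (∃[ π′ ] π ≡ ν ∷ π′ × CoGradTail K ws ν σ π′) ⇔ CoGradientPath K ws ν σ π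
    paths π = mk⇔ (λ { (_ , refl , tail) → refl , tail }) (split π)
      where
      split : ∀ π → CoGradientPath K ws ν σ π → ∃[ π′ ] π ≡ ν ∷ π′ × CoGradTail K ws ν σ π′
      split (_ ∷ π′) (refl , tail) = π′ , refl , tail

module CoGradientPaths
  {K ws Υ ν} (KC : IsComplex K) (steps : ValidSteps [] ws)
  (K⊆added : ∀ {y} → y ∈ K → y ∈ added ws)
  (Υ-critical : ∀ σ → Critical ws σ → ∀ ν → Υ σ ν ≡ (σ == ν))
  (Υ-regular : ∀ σ τ → RegularPair ws σ τ →
                 (∀ ν → Υ σ ν ≡ false) × (∀ ν → Υ τ ν ≡ evalChain Υ (δ K σ ∖ τ) ν))
  (ν-critical : Critical ws ν) where

  open MorseSequence (proj₁ (added-unique steps))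

  PathParity : Simplex → Set
  PathParity x = CountParity (CoGradTail K ws ν x) (Υ x ν)

  critical-parity : ∀ {x} → Critical ws x → PathParity x
  critical-parity {x} c =
    subst (CountParity _) (sym (Υ-critical x c ν)) (countParity-== [] x ν paths)
    where
    only-trivial : ∀ π → CoGradTail K ws ν x π → x ≡ ν × π ≡ []
    only-trivial π tail with coGradTail-last π tail
    ... | inj₁ (π≡[] , ν≡x)               = sym ν≡x , π≡[]
    ... | inj₂ (_ , _ , _ , _ , _ , r , _) = ⊥-elim (critical-not-upper c r)
    paths : ∀ π → CoGradTail K ws ν x π ⇔ (x ≡ ν × π ≡ [])
    paths π = mk⇔ (only-trivial π) λ { (refl , refl) → refl }

  lower-parity : ∀ {x t} → RegularPair ws x t → PathParity x
  lower-parity {x} {t} r =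
    subst (CountParity _) (sym (proj₁ (Υ-regular x t r) ν)) (countParity-empty no-path)
    where
    no-path : ∀ π → ¬ CoGradTail K ws ν x π
    no-path π tail with coGradTail-last π tail
    ... | inj₁ (_ , refl)                   = critical-not-lower ν-critical r
    ... | inj₂ (_ , _ , _ , _ , _ , r′ , _) = upper-not-lower r′ r

  upper-parity : ∀ {s x} → RegularPair ws s x → (∀ y → y ∈ δ K s ∖ x → PathParity y) → PathParity x
  upper-parity {s} {x} r IH =
    subst (CountParity _) (sym (proj₂ (Υ-regular s x r) ν))
      (countParity-cong paths
        (countParity-image (_++ s ∷ x ∷ []) (++-cancelʳ (s ∷ x ∷ []) _ _)
          (countParity-⋃ (λ y → CoGradTail K ws ν y) (λ y → Υ y ν)
            (∖-δ-unique (proj₁ KC) s x) IH (λ y y′ π → coGradTail-end-unique π))))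
    where
    Extension : List Simplex → Set
    Extension π = ∃[ π′ ] π ≡ π′ ++ s ∷ x ∷ [] × ∃[ y ] y ∈ δ K s ∖ x × CoGradTail K ws ν y π′
    extend : ∀ π → Extension π → CoGradTail K ws ν x π
    extend _ (π′ , refl , y , y∈ , tail) =
      let y∈δ , y≢x = to ∈-∖ y∈ in coGradTail-∷ʳ π′ tail r y∈δ (y≢x ∘ sym)
    restrict : ∀ π → CoGradTail K ws ν x π → Extension π
    restrict π tail with coGradTail-last π tail
    ... | inj₁ (_ , refl) = ⊥-elim (critical-not-upper ν-critical r)
    ... | inj₂ (π′ , _ , τ′ , π≡ , tail′ , r′ , τ′∈ , x≢τ′) with regularPair-lower-unique r r′
    ... | refl = π′ , π≡ , τ′ , from ∈-∖ (τ′∈ , x≢τ′ ∘ sym) , tail′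
    paths : ∀ π → Extension π ⇔ CoGradTail K ws ν x π
    paths π = mk⇔ (extend π) (restrict π)

  parities : All PathParity (added ws)
  parities =
    backward-induction K PathParity steps (inj₂ ∘ K⊆added) critical-parity lower-parity upper-parity

proposition1 : (K : Complex) (ws : List Step) (Υ Υ* : Frame) (p : ℕ) (σ ν : Simplex)
    → IsComplex K
    → IsMorseSeq K ws
    → IsMorseReference K ws Υ
    → IsMorseCoReference K ws Υ*
    → σ ∈ K → length σ ≡ suc p
    → ν ∈ K → length ν ≡ suc p
    → Critical ws ν
    → MemberIffOddCount (GradientPath K ws σ ν) (Υ σ ν)
      × MemberIffOddCount (CoGradientPath K ws ν σ) (Υ* σ ν)
proposition1 K ws Υ Υ* _ σ ν KC (steps , K⇔added)
             (_ , Υ-critical , Υ-regular) (_ , Υ*-critical , Υ*-regular) σ∈K _ _ _ ν-critical =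
  countParity⇒memberIffOddCount
    (All.lookup (GradientPaths.parities KC steps Υ-critical Υ-regular ν-critical) σ∈added) ,
  countParity⇒memberIffOddCount (coGradientPath-parity
    (All.lookup (CoGradientPaths.parities KC steps K⊆added Υ*-critical Υ*-regular ν-critical)
                σ∈added))
  where
  K⊆added : ∀ {y} → y ∈ K → y ∈ added ws
  K⊆added {y} = to (K⇔added y)
  σ∈added : σ ∈ added ws
  σ∈added = K⊆added σ∈K
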